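{- Let $m,n\geq 2$ and $k_1=\lfloor m/3\rfloor$. Then: (i) if $m\equiv 0 \pmod 3$, then $\gamma(\overrightarrow{C_m}\Box \overrightarrow{C_n})\geq nk_1$; (ii) if $m\equiv 1 \pmod 3$, then $\gamma(\overrightarrow{C_m}\Box \overrightarrow{C_n})\geq nk_1+\frac{n}{2}$; (iii) if $m\equiv 2 \pmod 3$, then $\gamma(\overrightarrow{C_m}\Box \overrightarrow{C_n})\geq nk_1+n$.
   Context: For a digraph $D=(V,A)$, a vertex $u$ dominates $v$ if $u=v$ or $uv\in A$; a set $W\subseteq V$ is dominating if every vertex is dominated by some vertex of $W$; the domination number $\gamma(D)$ is the minimum size of a dominating set. The directed cycle $\overrightarrow{C_n}$ has vertex set $\{0,1,\dots,n-1\}$ (integers mod $n$) and arcs $x\to x+1 \pmod n$. The Cartesian product $D_1\Box D_2$ of digraphs $D_1=(V_1,A_1)$, $D_2=(V_2,A_2)$ has vertex set $V_1\times V_2$ and an arc $(x_1,x_2)\to(y_1,y_2)$ iff either $x_1y_1\in A_1$ and $x_2=y_2$, or $x_2y_2\in A_2$ and $x_1=y_1$. -}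

module Defs where

open import Level using (0ℓ)
open import Data.Nat using (ℕ; zero; suc; _<_)
open import Data.Fin using (Fin; toℕ)
open import Data.Product using (_×_; _,_; ∃-syntax)
open import Data.Sum using (_⊎_)
open import Data.List using (List)
open import Data.List.Membership.Propositional using (_∈_)
open import Relation.Binary.PropositionalEquality using (_≡_)

record Digraph : Set₁ where
  field
    V   : Set
    Arc : V → V → Set
open Digraph public

Dominates : (D : Digraph) → V D → V D → Set
Dominates D u v = u ≡ v ⊎ Arc D u v

-- A (finite) vertex set, given as a duplicate-free list (uniqueness is
-- required separately in the statement), is dominating if every vertex is
-- dominated by some member.
IsDominating : (D : Digraph) → List (V D) → Set
IsDominating D W = ∀ v → ∃[ u ] (u ∈ W × Dominates D u v)

-- Arc x → x+1 (mod m) on Fin m.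
CycleArc : (m : ℕ) → Fin m → Fin m → Set
CycleArc m x y =
  (suc (toℕ x) < m × toℕ y ≡ suc (toℕ x)) ⊎ (suc (toℕ x) ≡ m × toℕ y ≡ 0)

Cycle : ℕ → Digraph
Cycle m = record { V = Fin m ; Arc = CycleArc m }

_□_ : Digraph → Digraph → Digraph
D₁ □ D₂ = record
  { V   = V D₁ × V D₂
  ; Arc = λ { (x₁ , x₂) (y₁ , y₂) →
              (Arc D₁ x₁ y₁ × x₂ ≡ y₂) ⊎ (x₁ ≡ y₁ × Arc D₂ x₂ y₂) }
  }

module Submission where

-- Let W dominate C_m □ C_n and let a_y be the number of vertices of W in
-- row y (second coordinate y).  A vertex of row y dominates itself and its
-- successor in the row, a vertex of row y - 1 exactly one vertex of row y, so
-- covering the m vertices of row y needs  m ≤ 2 a_y + a_{y-1}  (rows mod n).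
-- With m = 3k + r this forces, whenever a_y is below a target T, the pair
-- a_y + a_{y-1} to be at least 2T.  Discharging (row y - 1 passes its excess
-- over T to row y: T ≤ min(T, a_y) + (a_{y-1} ∸ T), summed around the cycle)
-- gives n T ≤ Σ_y a_y ≤ |W|, with T = k, k + 1 for r = 0, 2 and T = 2k + 1
-- for the doubled sequence 2a when r = 1.

open import Defs
open import Data.Nat using (ℕ; zero; suc; _+_; _*_; _≤_; _<_; _/_; _%_; _∸_; _⊓_; z≤n; _≟_; _≤?_)
open import Data.Nat.Properties
open import Data.Nat.DivMod using (m≡m%n+[m/n]*n)
open import Data.Nat.Tactic.RingSolver using (solve-∀)
open import Data.Fin using (Fin; toℕ; fromℕ<)
open import Data.Fin.Properties using (toℕ-fromℕ<; toℕ-injective; toℕ<n; injective⇒≤)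
open import Data.Product using (_×_; _,_; proj₂)
open import Data.Sum using (inj₁; inj₂)
open import Data.List using (List; length; []; _∷_; _++_; map; lookup)
open import Data.List.Properties using (length-++; length-map)
open import Data.List.Membership.Propositional using (_∈_)
open import Data.List.Membership.Propositional.Properties using (∈-++⁺ˡ; ∈-++⁺ʳ)
open import Data.List.Relation.Unary.Any using (here; there; index)
open import Data.List.Relation.Unary.Any.Properties using (lookup-index)
open import Data.List.Relation.Unary.Unique.Propositional using (Unique)
open import Relation.Nullary using (yes; no)
open import Data.Empty using (⊥-elim)
open import Relation.Binary.PropositionalEquality using (_≡_; refl; sym; trans; cong; cong₂; subst; subst₂; module ≡-Reasoning)

Σ : ℕ → (ℕ → ℕ) → ℕ
Σ zero    f = 0
Σ (suc n) f = Σ n f + f n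

Σ-cong : ∀ n {f g : ℕ → ℕ} → (∀ i → f i ≡ g i) → Σ n f ≡ Σ n g
Σ-cong zero    f≡g = refl
Σ-cong (suc n) f≡g = cong₂ _+_ (Σ-cong n f≡g) (f≡g n)

Σ-mono : ∀ n {f g : ℕ → ℕ} → (∀ i → i < n → f i ≤ g i) → Σ n f ≤ Σ n g
Σ-mono zero    f≤g = z≤n
Σ-mono (suc n) f≤g = +-mono-≤ (Σ-mono n (λ i i<n → f≤g i (m≤n⇒m≤1+n i<n))) (f≤g n ≤-refl)

Σ-const : ∀ n c → Σ n (λ _ → c) ≡ n * c
Σ-const zero    c = refl
Σ-const (suc n) c = trans (cong (_+ c) (Σ-const n c)) (+-comm (n * c) c)

Σ-+ : ∀ n (f g : ℕ → ℕ) → Σ n (λ i → f i + g i) ≡ Σ n f + Σ n g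
Σ-+ zero    f g = refl
Σ-+ (suc n) f g = trans (cong (_+ (f n + g n)) (Σ-+ n f g)) (+-interchange (Σ n f) (Σ n g) (f n) (g n))
  where
  +-interchange : ∀ a b c d → (a + b) + (c + d) ≡ (a + c) + (b + d)
  +-interchange = solve-∀

Σ-scale : ∀ n c (f : ℕ → ℕ) → Σ n (λ i → c * f i) ≡ c * Σ n f
Σ-scale zero    c f = sym (*-zeroʳ c)
Σ-scale (suc n) c f = trans (cong (_+ c * f n) (Σ-scale n c f)) (sym (*-distribˡ-+ c (Σ n f) (f n)))

Σ-head : ∀ n (f : ℕ → ℕ) → Σ (suc n) f ≡ f 0 + Σ n (λ i → f (suc i))
Σ-head zero    f = +-comm 0 (f 0)
Σ-head (suc n) f = trans (cong (_+ f (suc n)) (Σ-head n f)) (+-assoc (f 0) _ _)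

prev : ℕ → ℕ → ℕ
prev N zero    = N ∸ 1
prev N (suc y) = y

Σ-rotate : ∀ N (g : ℕ → ℕ) → Σ N (λ y → g (prev N y)) ≡ Σ N g
Σ-rotate zero    g = refl
Σ-rotate (suc n) g = trans (Σ-head n (λ y → g (prev (suc n) y))) (+-comm (g n) (Σ n g))

-- Occurrence counts.  Each list element is counted for exactly one value,
-- so the counts of the values below n add up to at most the length.

indicator : ℕ → ℕ → ℕ
indicator i j with i ≟ j
... | yes _ = 1
... | no  _ = 0

Σ-indicator-below : ∀ n j → n ≤ j → Σ n (λ i → indicator i j) ≡ 0
Σ-indicator-below zero    j n≤j = refl
Σ-indicator-below (suc n) j n<j with n ≟ j
... | yes refl = ⊥-elim (<-irrefl refl n<j)
... | no  _    = trans (+-identityʳ _) (Σ-indicator-below n j (<⇒≤ n<j))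

Σ-indicator≤1 : ∀ n j → Σ n (λ i → indicator i j) ≤ 1
Σ-indicator≤1 zero    j = z≤n
Σ-indicator≤1 (suc n) j with n ≟ j
... | yes refl = ≤-reflexive (cong (_+ 1) (Σ-indicator-below n n ≤-refl))
... | no  _    = ≤-trans (≤-reflexive (+-identityʳ _)) (Σ-indicator≤1 n j)

count : ℕ → List ℕ → ℕ
count i []      = 0
count i (j ∷ L) = indicator i j + count i L

Σ-count≤length : ∀ n L → Σ n (λ i → count i L) ≤ length L
Σ-count≤length n []      = ≤-reflexive (trans (Σ-const n 0) (*-zeroʳ n))
Σ-count≤length n (j ∷ L) = ≤-trans (≤-reflexive (Σ-+ n (λ i → indicator i j) (λ i → count i L)))
  (+-mono-≤ (Σ-indicator≤1 n j) (Σ-count≤length n L))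

-- A list containing every number below m has length at least m: the
-- positions of these numbers in the list are pairwise distinct.
covering-length : ∀ m (L : List ℕ) → (∀ i → i < m → i ∈ L) → m ≤ length L
covering-length m L covers = injective⇒≤ {f = position} position-injective
  where
  position : Fin m → Fin (length L)
  position i = index (covers (toℕ i) (toℕ<n i))

  position-injective : ∀ {i j} → position i ≡ position j → i ≡ j
  position-injective {i} {j} same = toℕ-injective (begin
    toℕ i                 ≡⟨ lookup-index (covers (toℕ i) (toℕ<n i)) ⟩
    lookup L (position i) ≡⟨ cong (lookup L) same ⟩
    lookup L (position j) ≡⟨ sym (lookup-index (covers (toℕ j) (toℕ<n j))) ⟩
    toℕ j                 ∎)
    where open ≡-Reasoning

row : ∀ {m n} → Fin m × Fin n → ℕ
row u = toℕ (proj₂ u)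

rowCount : ∀ {m n} → List (Fin m × Fin n) → ℕ → ℕ
rowCount W y = count y (map row W)

next : ℕ → ℕ → ℕ
next m i with suc i ≟ m
... | yes _ = 0
... | no  _ = suc i

cycleArc-next : ∀ {m} {a x : Fin m} → CycleArc m a x → toℕ x ≡ next m (toℕ a)
cycleArc-next {m} {a} _ with suc (toℕ a) ≟ m
cycleArc-next (inj₁ (a+1<m , _)) | yes a+1≡m = ⊥-elim (<-irrefl a+1≡m a+1<m)
cycleArc-next (inj₂ (_ , x≡0))   | yes _     = x≡0
cycleArc-next (inj₁ (_ , x≡a+1)) | no  _     = x≡a+1
cycleArc-next (inj₂ (a+1≡m , _)) | no  a+1≢m = ⊥-elim (a+1≢m a+1≡m)

cycleArc-prev : ∀ {n} {b y : Fin n} → CycleArc n b y → toℕ b ≡ prev n (toℕ y)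
cycleArc-prev (inj₁ (_ , y≡b+1))   rewrite y≡b+1 = refl
cycleArc-prev (inj₂ (b+1≡n , y≡0)) rewrite y≡0   = cong (_∸ 1) b+1≡n

columnsDominated : ∀ {m n} → ℕ → Fin m × Fin n → List ℕ
columnsDominated {m} {n} y (a , b) with y ≟ toℕ b
... | yes _ = toℕ a ∷ next m (toℕ a) ∷ []
... | no  _ with prev n y ≟ toℕ b
...   | yes _ = toℕ a ∷ []
...   | no  _ = []

columnsDominated-length : ∀ {m n} y (u : Fin m × Fin n) →
  length (columnsDominated y u) ≤ 2 * indicator y (row u) + indicator (prev n y) (row u)
columnsDominated-length {n = n} y (a , b) with y ≟ toℕ b
... | yes _ = m≤m+n 2 _
... | no  _ with prev n y ≟ toℕ b
...   | yes _ = ≤-refl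
...   | no  _ = z≤n

columnsDominated-complete : ∀ {m n} (u : Fin m × Fin n) (x : Fin m) (y : Fin n) →
  Dominates (Cycle m □ Cycle n) u (x , y) → toℕ x ∈ columnsDominated (toℕ y) u
columnsDominated-complete (a , b) x y _ with toℕ y ≟ toℕ b
columnsDominated-complete (a , b) x y (inj₁ refl)                 | yes _ = here refl
columnsDominated-complete (a , b) x y (inj₂ (inj₁ (arc , _)))     | yes _ = there (here (cycleArc-next arc))
columnsDominated-complete (a , b) x y (inj₂ (inj₂ (refl , _)))    | yes _ = here refl
columnsDominated-complete (a , b) x y (inj₁ refl)                 | no y≢b = ⊥-elim (y≢b refl)
columnsDominated-complete (a , b) x y (inj₂ (inj₁ (_ , refl)))    | no y≢b = ⊥-elim (y≢b refl)
columnsDominated-complete {n = n} (a , b) x y (inj₂ (inj₂ (refl , arc))) | no _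
  with prev n (toℕ y) ≟ toℕ b
... | yes _     = here refl
... | no prev≢b = ⊥-elim (prev≢b (sym (cycleArc-prev arc)))

rowCover : ∀ {m n} → ℕ → List (Fin m × Fin n) → List ℕ
rowCover y []      = []
rowCover y (u ∷ W) = columnsDominated y u ++ rowCover y W

rowCover-length : ∀ {m n} y (W : List (Fin m × Fin n)) →
  length (rowCover y W) ≤ 2 * rowCount W y + rowCount W (prev n y)
rowCover-length y []      = z≤n
rowCover-length {n = n} y (u ∷ W) = begin
  length (columnsDominated y u ++ rowCover y W)             ≡⟨ length-++ (columnsDominated y u) ⟩
  length (columnsDominated y u) + length (rowCover y W)     ≤⟨ +-mono-≤ (columnsDominated-length y u) (rowCover-length y W) ⟩
  (2 * i + j) + (2 * rowCount W y + rowCount W (prev n y))  ≡⟨ regroup i j (rowCount W y) _ ⟩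
  2 * (i + rowCount W y) + (j + rowCount W (prev n y))      ∎
  where
  open ≤-Reasoning
  i j : ℕ
  i = indicator y (row u)
  j = indicator (prev n y) (row u)
  regroup : ∀ a b c d → (2 * a + b) + (2 * c + d) ≡ 2 * (a + c) + (b + d)
  regroup = solve-∀

rowCover-complete : ∀ {m n} (W : List (Fin m × Fin n)) (u : Fin m × Fin n) (x : Fin m) (y : Fin n) →
  u ∈ W → Dominates (Cycle m □ Cycle n) u (x , y) → toℕ x ∈ rowCover (toℕ y) W
rowCover-complete (v ∷ W) u x y (here refl) dom = ∈-++⁺ˡ (columnsDominated-complete u x y dom)
rowCover-complete (v ∷ W) u x y (there u∈W) dom = ∈-++⁺ʳ (columnsDominated (toℕ y) v) (rowCover-complete W u x y u∈W dom)

-- Row y has m vertices, each dominated by a vertex of W in row y or prev y.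
rowInequality : ∀ m n (W : List (Fin m × Fin n)) → IsDominating (Cycle m □ Cycle n) W →
  ∀ y → y < n → m ≤ 2 * rowCount W y + rowCount W (prev n y)
rowInequality m n W dominating y y<n =
  ≤-trans (covering-length m (rowCover y W) covered) (rowCover-length y W)
  where
  covered : ∀ i → i < m → i ∈ rowCover y W
  covered i i<m with dominating (fromℕ< i<m , fromℕ< y<n)
  ... | u , u∈W , dom = subst₂ _∈_ (toℕ-fromℕ< i<m) (cong (λ z → rowCover z W) (toℕ-fromℕ< y<n))
                          (rowCover-complete W u (fromℕ< i<m) (fromℕ< y<n) u∈W dom)

-- Discharging around a cycle.  A term f below the target T must be
-- compensated by its predecessor g; the excess g ∸ T passed on by the
-- predecessor then lifts min(T, f) up to T.
discharge : ∀ T f g → (f < T → T + T ≤ f + g) → T ≤ T ⊓ f + (g ∸ T)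
discharge T f g compensated with T ≤? f
... | yes T≤f = ≤-trans (m≤m+n T (g ∸ T)) (≤-reflexive (cong (_+ (g ∸ T)) (sym (m≤n⇒m⊓n≡m T≤f))))
... | no  T≰f = subst (λ h → T ≤ h + (g ∸ T)) (sym (m≥n⇒m⊓n≡n (<⇒≤ f<T))) (+-cancelˡ-≤ T T _ (begin
      T + T              ≤⟨ compensated f<T ⟩
      f + g              ≤⟨ +-monoʳ-≤ f (m≤n+m∸n g T) ⟩
      f + (T + (g ∸ T))  ≡⟨ +-comm-middle f T (g ∸ T) ⟩
      T + (f + (g ∸ T))  ∎))
  where
  open ≤-Reasoning
  f<T : f < T
  f<T = ≰⇒> T≰f
  +-comm-middle : ∀ a b c → a + (b + c) ≡ b + (a + c)
  +-comm-middle = solve-∀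

cyclicAverage : ∀ N T (f : ℕ → ℕ) →
  (∀ y → y < N → f y < T → T + T ≤ f y + f (prev N y)) → N * T ≤ Σ N f
cyclicAverage N T f compensated = begin
  N * T                                               ≡⟨ sym (Σ-const N T) ⟩
  Σ N (λ _ → T)                                       ≤⟨ Σ-mono N (λ y y<N → discharge T (f y) (f (prev N y)) (compensated y y<N)) ⟩
  Σ N (λ y → T ⊓ f y + (f (prev N y) ∸ T))            ≡⟨ Σ-+ N (λ y → T ⊓ f y) (λ y → f (prev N y) ∸ T) ⟩
  Σ N (λ y → T ⊓ f y) + Σ N (λ y → f (prev N y) ∸ T)  ≡⟨ cong (Σ N (λ y → T ⊓ f y) +_) (Σ-rotate N (λ y → f y ∸ T)) ⟩
  Σ N (λ y → T ⊓ f y) + Σ N (λ y → f y ∸ T)           ≡⟨ sym (Σ-+ N (λ y → T ⊓ f y) (λ y → f y ∸ T)) ⟩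
  Σ N (λ y → T ⊓ f y + (f y ∸ T))                     ≡⟨ Σ-cong N (λ y → m⊓n+n∸m≡n T (f y)) ⟩
  Σ N f                                               ∎
  where open ≤-Reasoning

RowInequality : ℕ → ℕ → ℕ → (ℕ → ℕ) → Set
RowInequality N r k a = ∀ y → y < N → r + k * 3 ≤ 2 * a y + a (prev N y)

pairBound : ∀ c k x z → x ≤ k → c + k * 3 ≤ 2 * x + z → c + (k + k) ≤ x + z
pairBound c k x z x≤k row = +-cancelʳ-≤ k (c + (k + k)) (x + z) (begin
  c + (k + k) + k  ≡⟨ triple c k ⟩
  c + k * 3        ≤⟨ row ⟩
  2 * x + z        ≡⟨ double x z ⟩
  x + z + x        ≤⟨ +-monoʳ-≤ (x + z) x≤k ⟩
  x + z + k        ∎)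
  where
  open ≤-Reasoning
  triple : ∀ c k → c + (k + k) + k ≡ c + k * 3
  triple = solve-∀
  double : ∀ x z → 2 * x + z ≡ x + z + x
  double = solve-∀

cyclicBound₀ : ∀ N k a → RowInequality N 0 k a → N * k ≤ Σ N a
cyclicBound₀ N k a rows = cyclicAverage N k a
  (λ y y<N a<k → pairBound 0 k (a y) (a (prev N y)) (<⇒≤ a<k) (rows y y<N))

cyclicBound₂ : ∀ N k a → RowInequality N 2 k a → N * k + N ≤ Σ N a
cyclicBound₂ N k a rows = subst (_≤ Σ N a) (distrib N k) (cyclicAverage N (suc k) a
  (λ y y<N a≤k → subst (_≤ a y + a (prev N y)) (sym (+-suc (suc k) k))
    (pairBound 2 k (a y) (a (prev N y)) (≤-pred a≤k) (rows y y<N))))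
  where
  distrib : ∀ N k → N * suc k ≡ N * k + N
  distrib = solve-∀

-- For m ≡ 1 the bound n k + n/2 is half-integral, so the target is 2k + 1
-- for the doubled sequence 2a.
cyclicBound₁ : ∀ N k a → RowInequality N 1 k a → 2 * (N * k) + N ≤ 2 * Σ N a
cyclicBound₁ N k a rows = begin
  2 * (N * k) + N               ≡⟨ distrib N k ⟩
  N * (2 * k + 1)               ≤⟨ cyclicAverage N (2 * k + 1) (λ y → 2 * a y) compensated ⟩
  Σ N (λ y → 2 * a y)           ≡⟨ Σ-scale N 2 a ⟩
  2 * Σ N a                     ∎
  where
  open ≤-Reasoning
  distrib : ∀ N k → 2 * (N * k) + N ≡ N * (2 * k + 1)
  distrib = solve-∀
  doubled : ∀ k → (2 * k + 1) + (2 * k + 1) ≡ 2 * (1 + (k + k))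
  doubled = solve-∀
  halve : ∀ x → 2 * x < 2 * k + 1 → x ≤ k
  halve x 2x<2k+1 = *-cancelˡ-≤ 2 (≤-pred (≤-trans 2x<2k+1 (≤-reflexive (+-comm (2 * k) 1))))
  compensated : ∀ y → y < N → 2 * a y < 2 * k + 1 → (2 * k + 1) + (2 * k + 1) ≤ 2 * a y + 2 * a (prev N y)
  compensated y y<N small = begin
    (2 * k + 1) + (2 * k + 1)   ≡⟨ doubled k ⟩
    2 * (1 + (k + k))           ≤⟨ *-monoʳ-≤ 2 (pairBound 1 k (a y) (a (prev N y)) (halve (a y) small) (rows y y<N)) ⟩
    2 * (a y + a (prev N y))    ≡⟨ *-distribˡ-+ 2 (a y) (a (prev N y)) ⟩
    2 * a y + 2 * a (prev N y)  ∎

-- Every vertex of W lies in exactly one row.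
Σ-rowCount≤length : ∀ {m} n (W : List (Fin m × Fin n)) → Σ n (rowCount W) ≤ length W
Σ-rowCount≤length n W = subst (Σ n (rowCount W) ≤_) (length-map row W) (Σ-count≤length n (map row W))

rowInequality-mod3 : ∀ m n (W : List (Fin m × Fin n)) → IsDominating (Cycle m □ Cycle n) W →
  ∀ r → m % 3 ≡ r → RowInequality n r (m / 3) (rowCount W)
rowInequality-mod3 m n W dominating r m%3≡r y y<n =
  subst (_≤ 2 * rowCount W y + rowCount W (prev n y))
        (trans (m≡m%n+[m/n]*n m 3) (cong (_+ (m / 3) * 3) m%3≡r))
        (rowInequality m n W dominating y y<n)

mainTheorem2 : (m n : ℕ) → 2 ≤ m → 2 ≤ n →
    (W : List (Fin m × Fin n)) → Unique W → IsDominating (Cycle m □ Cycle n) W →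
    (m % 3 ≡ 0 → n * (m / 3) ≤ length W) ×
    (m % 3 ≡ 1 → 2 * (n * (m / 3)) + n ≤ 2 * length W) ×
    (m % 3 ≡ 2 → n * (m / 3) + n ≤ length W)
mainTheorem2 m n _ _ W _ dominating =
    (λ r≡0 → ≤-trans (cyclicBound₀ n k a (rows 0 r≡0)) total)
  , (λ r≡1 → ≤-trans (cyclicBound₁ n k a (rows 1 r≡1)) (*-monoʳ-≤ 2 total))
  , (λ r≡2 → ≤-trans (cyclicBound₂ n k a (rows 2 r≡2)) total)
  where
  k : ℕ
  k = m / 3
  a : ℕ → ℕ
  a = rowCount W
  rows : ∀ r → m % 3 ≡ r → RowInequality n r k a
  rows = rowInequality-mod3 m n W dominating
  total : Σ n a ≤ length W
  total = Σ-rowCount≤length n W
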